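{- Let $\{U_1,\dots,U_N\}$ be a collection of $(h-1)$-dimensional projective subspaces of $\mathrm{PG}(k-1,q)$ which does not have the avoidance property. If $U:=\bigcup_{i=1}^N U_i$ is a strong blocking set, then $N\ge q+1$.
   Context: A collection of $(h-1)$-dimensional subspaces $U_1,\dots,U_N$ of $\mathrm{PG}(k-1,q)$ has the avoidance property if there is no subspace $\Lambda$ of codimension $2$ in $\mathrm{PG}(k-1,q)$ with $\dim(\Lambda\cap U_i)\ge h-2$ for every $i\in[N]$ (projective dimensions). A strong blocking set in $\mathrm{PG}(k-1,q)$ is a set of points $\mathcal{M}$ with $\langle\mathcal{M}\cap H\rangle=H$ for every hyperplane $H$. -}

module Defs where

open import Level using (0ℓ)
open import Algebra.Bundles using (CommutativeRing)
open import Data.Nat using (ℕ; zero; suc; _≤_; _∸_)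
open import Data.Fin using (Fin; zero; suc)
open import Data.Product using (Σ; ∃; _×_; _,_)
open import Relation.Nullary using (¬_)
open import Relation.Binary.PropositionalEquality using (_≡_)

record FiniteField (q : ℕ) : Set₁ where
  field
    cring : CommutativeRing 0ℓ 0ℓ
  open CommutativeRing cring public
  field
    1≉0             : ¬ (1# ≈ 0#)
    inverse         : ∀ x → ¬ (x ≈ 0#) → ∃ λ y → x * y ≈ 1#
    enum            : Fin q → Carrier
    enum-injective  : ∀ i j → enum i ≈ enum j → i ≡ j
    enum-surjective : ∀ x → ∃ λ i → enum i ≈ x

-- Projective geometry PG(k-1,q), modelled through the underlying vector
-- space V = GF(q)^k.  A projective subspace of projective dimension d is a
-- linear subspace of V of vector dimension d+1; a projective point is a
-- nonzero vector (up to scalars).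
module PG {q : ℕ} (F : FiniteField q) (k : ℕ) where
  open FiniteField F using (Carrier; _≈_; _+_; _*_; 0#; 1#)

  Vec : Set
  Vec = Fin k → Carrier

  _≈v_ : Vec → Vec → Set
  u ≈v v = ∀ i → u i ≈ v i

  0v : Vec
  0v _ = 0#

  _+v_ : Vec → Vec → Vec
  (u +v v) i = u i + v i

  _·_ : Carrier → Vec → Vec
  (c · v) i = c * v i

  sumv : ∀ {m} → (Fin m → Vec) → Vec
  sumv {zero}  f = 0v
  sumv {suc m} f = f zero +v sumv (λ i → f (suc i))

  VSet : Set₁
  VSet = Vec → Set

  _∩_ : VSet → VSet → VSet
  (A ∩ B) v = A v × B v

  record IsSubspace (S : VSet) : Set where
    field
      respects : ∀ {u v} → u ≈v v → S u → S v
      has-0    : S 0v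
      +-closed : ∀ {u v} → S u → S v → S (u +v v)
      ·-closed : ∀ c {v} → S v → S (c · v)

  LinIndep : ∀ {d} → (Fin d → Vec) → Set
  LinIndep {d} b = ∀ (c : Fin d → Carrier) → sumv (λ i → c i · b i) ≈v 0v → ∀ i → c i ≈ 0#

  InSpan : VSet → VSet
  InSpan P w = Σ ℕ λ m → Σ (Fin m → Vec) λ v → Σ (Fin m → Carrier) λ c →
                 (∀ i → P (v i)) × (sumv (λ i → c i · v i) ≈v w)

  HasDim : VSet → ℕ → Set
  HasDim S d = Σ (Fin d → Vec) λ b →
                 (∀ i → S (b i)) × LinIndep b × (∀ w → S w → InSpan (λ v → Σ (Fin d) λ i → b i ≡ v) w)

  ProjSubspaceVecDim : VSet → ℕ → Set
  ProjSubspaceVecDim S n = IsSubspace S × HasDim S n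

  IsHyperplane : VSet → Set
  IsHyperplane H = ProjSubspaceVecDim H (k ∸ 1)

  -- a set of points is given by a set M of nonzero vectors
  -- strong blocking set: ⟨M ∩ H⟩ = H for every hyperplane H
  StrongBlocking : VSet → Set₁
  StrongBlocking M = ∀ H → IsHyperplane H →
    (∀ w → InSpan (M ∩ H) w → H w) × (∀ w → H w → InSpan (M ∩ H) w)

  PointUnion : ∀ {N} → (Fin N → VSet) → VSet
  PointUnion U v = (¬ (v ≈v 0v)) × (∃ λ i → U i v)

  -- avoidance property for a collection of (h-1)-dim projective subspaces:
  -- no Λ of codimension 2 (vector dimension k-2) with
  -- dim(Λ ∩ U_i) ≥ h-2 (projective), i.e. vector dimension ≥ h-1, for all i.
  AvoidanceProperty : ∀ {N} → ℕ → (Fin N → VSet) → Set₁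
  AvoidanceProperty h U = ¬ (Σ VSet λ Λ → ProjSubspaceVecDim Λ (k ∸ 2) ×
                             (∀ i → Σ ℕ λ m → (h ∸ 1 ≤ m) × HasDim (Λ ∩ U i) m))

-- Let Λ be a codimension-2 subspace with dim(Λ ∩ U_i) ≥ h - 2 for all i. Each of the q + 1
-- hyperplanes H through Λ contains a point of U outside Λ, since U ∩ H spans H ⊄ Λ. If N ≤ q,
-- two hyperplanes H ≠ H′ receive such points u, u′ from the same U_i; as H ∩ H′ = Λ, the points
-- u, u′ and a basis of Λ ∩ U_i are independent in U_i, so h ≥ (h - 1) + 2. Membership in Λ is
-- not decidable, so these choices are made under a double negation, which the goal ⊥ absorbs.
module Submission where

open import Defs
open import Data.Nat using (ℕ; zero; suc; _≤_; _<_; _∸_; s≤s; z≤n; _≤?_)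
import Data.Nat.Properties as ℕ
open import Data.Fin using (Fin; zero; suc; punchIn)
import Data.Fin.Properties as Fin
open import Data.Product using (Σ; ∃; _×_; _,_; proj₁; proj₂)
open import Data.Empty using (⊥; ⊥-elim)
open import Data.Vec.Functional using (_∷_; insertAt)
open import Data.Vec.Functional.Properties using (insertAt-lookup; insertAt-punchIn)
open import Function using (_∘_)
open import Relation.Nullary using (¬_; Dec; yes; no; ¬?)
import Relation.Binary.PropositionalEquality as ≡
open import Data.Maybe using (nothing)

¬¬-∀-Fin : ∀ {n} {P : Fin n → Set} → (∀ i → ¬ ¬ P i) → ¬ ¬ (∀ i → P i)
¬¬-∀-Fin {zero}      ¬¬P ¬∀P = ¬∀P (λ ())
¬¬-∀-Fin {suc n} {P} ¬¬P ¬∀P =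
  ¬¬P zero λ P₀ → ¬¬-∀-Fin {P = P ∘ suc} (¬¬P ∘ suc) λ P₊ → ¬∀P λ { zero → P₀ ; (suc i) → P₊ i }

module FiniteFieldProperties {q : ℕ} (F : FiniteField q) where
  open FiniteField F hiding (zero)
  open import Relation.Binary.Reasoning.Setoid setoid

  _≟_ : (x y : Carrier) → Dec (x ≈ y)
  x ≟ y with enum-surjective x | enum-surjective y
  ... | i , i↦x | j , j↦y with i Fin.≟ j
  ... | yes ≡.refl = yes (trans (sym i↦x) j↦y)
  ... | no i≢j     = no λ x≈y → i≢j (enum-injective i j (trans i↦x (trans x≈y (sym j↦y))))

  open import Algebra.Solver.Ring.NaturalCoefficients commutativeSemiring (λ _ _ → nothing) public
    using (solve; _:+_; _:*_; _:=_)

  *-cancelʳ-≉0 : ∀ x {y} → ¬ y ≈ 0# → x * y ≈ 0# → x ≈ 0#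
  *-cancelʳ-≉0 x {y} y≉0 xy≈0 = begin
    x             ≈⟨ sym (*-identityʳ x) ⟩
    x * 1#        ≈⟨ *-congˡ (sym yy⁻¹≈1) ⟩
    x * (y * y⁻¹) ≈⟨ sym (*-assoc x y y⁻¹) ⟩
    x * y * y⁻¹   ≈⟨ *-congʳ xy≈0 ⟩
    0# * y⁻¹      ≈⟨ zeroˡ y⁻¹ ⟩
    0#            ∎
    where
    y⁻¹ = proj₁ (inverse y y≉0)
    yy⁻¹≈1 = proj₂ (inverse y y≉0)

module ProjectiveLine {q : ℕ} (F : FiniteField q) where
  open FiniteField F hiding (zero)
  open FiniteFieldProperties F
  open import Relation.Binary.Reasoning.Setoid setoid

  -- Homogeneous coordinates of the q + 1 points (1 : 0) and (t : 1) of PG(1, q).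
  pointX pointY : Fin (suc q) → Carrier
  pointX zero    = 1#
  pointX (suc s) = enum s
  pointY zero    = 0#
  pointY (suc s) = 1#

  point-nonzero : ∀ τ x → x * pointX τ ≈ 0# → x * pointY τ ≈ 0# → x ≈ 0#
  point-nonzero zero    x x1≈0 _    = trans (sym (*-identityʳ x)) x1≈0
  point-nonzero (suc s) x _    x1≈0 = trans (sym (*-identityʳ x)) x1≈0

  distinct-points-independent : ∀ {τ σ} → τ ≡.≢ σ → ∀ X Y →
    X * pointX τ + Y * pointX σ ≈ 0# → X * pointY τ + Y * pointY σ ≈ 0# → X ≈ 0#
  distinct-points-independent {zero}  {zero}   τ≢σ = ⊥-elim (τ≢σ ≡.refl)
  distinct-points-independent {zero}  {suc s}  _ X Y e₁ e₂ = begin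
    X                   ≈⟨ sym (*-identityʳ X) ⟩
    X * 1#              ≈⟨ sym (+-identityʳ _) ⟩
    X * 1# + 0#         ≈⟨ +-congˡ (sym (trans (*-congʳ Y≈0) (zeroˡ _))) ⟩
    X * 1# + Y * enum s ≈⟨ e₁ ⟩
    0#                  ∎
    where
    Y≈0 : Y ≈ 0#
    Y≈0 = begin
      Y               ≈⟨ sym (*-identityʳ Y) ⟩
      Y * 1#          ≈⟨ sym (+-identityˡ _) ⟩
      0# + Y * 1#     ≈⟨ +-congʳ (sym (zeroʳ X)) ⟩
      X * 0# + Y * 1# ≈⟨ e₂ ⟩
      0#              ∎
  distinct-points-independent {suc s} {zero}   _ X Y _ e₂ = begin
    X               ≈⟨ sym (*-identityʳ X) ⟩
    X * 1#          ≈⟨ sym (+-identityʳ _) ⟩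
    X * 1# + 0#     ≈⟨ +-congˡ (sym (zeroʳ Y)) ⟩
    X * 1# + Y * 0# ≈⟨ e₂ ⟩
    0#              ∎
  distinct-points-independent {suc s} {suc s′} τ≢σ X Y e₁ e₂ = *-cancelʳ-≉0 X t-t′≉0 (begin
    X * (t - t′)                                 ≈⟨ sym (+-identityʳ _) ⟩
    X * (t - t′) + 0#                            ≈⟨ +-congˡ (sym (trans (*-congˡ (-‿inverseʳ t′)) (zeroʳ Y))) ⟩
    X * (t - t′) + Y * (t′ - t′)                 ≈⟨ sym (regroup X Y t t′ (- t′)) ⟩
    (X * t + Y * t′) + - t′ * (X + Y)            ≈⟨ +-cong e₁ (*-congˡ X+Y≈0) ⟩
    0# + - t′ * 0#                               ≈⟨ trans (+-identityˡ _) (zeroʳ _) ⟩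
    0#                                           ∎)
    where
    t  = enum s
    t′ = enum s′
    t-t′≉0 : ¬ t - t′ ≈ 0#
    t-t′≉0 t-t′≈0 = τ≢σ (≡.cong suc (enum-injective s s′ (x∙y⁻¹≈ε⇒x≈y t t′ t-t′≈0)))
      where open import Algebra.Properties.Group +-group using (x∙y⁻¹≈ε⇒x≈y)
    X+Y≈0 : X + Y ≈ 0#
    X+Y≈0 = trans (sym (+-cong (*-identityʳ X) (*-identityʳ Y))) e₂
    -- A semiring identity, with the negation -t′ kept as an opaque variable n.
    regroup : ∀ X Y t t′ n → (X * t + Y * t′) + n * (X + Y) ≈ X * (t + n) + Y * (t′ + n)
    regroup = solve 5 (λ X Y t t′ n → (X :* t :+ Y :* t′) :+ n :* (X :+ Y) := X :* (t :+ n) :+ Y :* (t′ :+ n)) refl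

module HomogeneousSystems {q : ℕ} (F : FiniteField q) where
  open FiniteField F hiding (zero)
  open FiniteFieldProperties F
  open import Algebra.Properties.Ring ring using (-‿distribˡ-*)
  open import Algebra.Properties.Semiring.Sum semiring
    using (sum-syntax; sum-cong-≋; sum-cong-≗; sum-replicate-zero; ∑-distrib-+; *-distribʳ-sum; sum-remove)
  open import Relation.Nullary.Decidable using (decidable-stable)
  open import Relation.Binary.Reasoning.Setoid setoid

  Solves : ∀ {n h} → (Fin n → Carrier) → (Fin n → Fin h → Carrier) → Set
  Solves {n} c A = ∀ i → ∑[ j < n ] (c j * A j i) ≈ 0#

  Nontrivial : ∀ {n} → (Fin n → Carrier) → Set
  Nontrivial c = ∃ λ j → ¬ c j ≈ 0#

  solves-zero-column : ∀ {n h} {c : Fin n → Carrier} (A : Fin n → Fin (suc h) → Carrier) →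
    (∀ j → A j zero ≈ 0#) → Solves c (λ j i → A j (suc i)) → Solves c A
  solves-zero-column {n} {c = c} A column₀≈0 _ zero = begin
    ∑[ j < n ] (c j * A j zero) ≈⟨ sum-cong-≋ (λ j → trans (*-congˡ (column₀≈0 j)) (zeroʳ (c j))) ⟩
    ∑[ j < n ] 0#               ≈⟨ sum-replicate-zero n ⟩
    0#                          ∎
  solves-zero-column A _ solves (suc i) = solves i

  module Elimination {n h} (A : Fin (suc n) → Fin (suc h) → Carrier)
                     (j₀ : Fin (suc n)) (pivot≉0 : ¬ A j₀ zero ≈ 0#) where

    p⁻¹ : Carrier
    p⁻¹ = proj₁ (inverse (A j₀ zero) pivot≉0)

    κ : Fin (suc h) → Carrier
    κ i = p⁻¹ * A j₀ i

    reduced : Fin n → Fin (suc h) → Carrier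
    reduced j i = A (punchIn j₀ j) i - A (punchIn j₀ j) zero * κ i

    reduced-column₀≈0 : ∀ j → reduced j zero ≈ 0#
    reduced-column₀≈0 j = begin
      a - a * (p⁻¹ * A j₀ zero) ≈⟨ +-congˡ (-‿cong (*-congˡ κ₀≈1)) ⟩
      a - a * 1#               ≈⟨ +-congˡ (-‿cong (*-identityʳ a)) ⟩
      a - a                    ≈⟨ -‿inverseʳ a ⟩
      0#                       ∎
      where
      a = A (punchIn j₀ j) zero
      κ₀≈1 = trans (*-comm p⁻¹ _) (proj₂ (inverse (A j₀ zero) pivot≉0))

    module _ (c′ : Fin n → Carrier) where

      S₀ : Carrier
      S₀ = ∑[ j < n ] (c′ j * A (punchIn j₀ j) zero)

      c : Fin (suc n) → Carrier
      c = insertAt c′ j₀ (- (S₀ * p⁻¹))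

      other-rows : Solves c′ reduced → ∀ i → ∑[ j < n ] (c′ j * A (punchIn j₀ j) i) ≈ S₀ * κ i
      other-rows solves′ i = begin
        ∑[ j < n ] (c′ j * A (punchIn j₀ j) i)
          ≈⟨ sum-cong-≋ (λ j → split (c′ j) (A (punchIn j₀ j) i) (A (punchIn j₀ j) zero * κ i)) ⟩
        ∑[ j < n ] (c′ j * reduced j i + c′ j * (A (punchIn j₀ j) zero * κ i))
          ≈⟨ ∑-distrib-+ (λ j → c′ j * reduced j i) _ ⟩
        ∑[ j < n ] (c′ j * reduced j i) + ∑[ j < n ] (c′ j * (A (punchIn j₀ j) zero * κ i))
          ≈⟨ +-cong (solves′ i) (sum-cong-≋ (λ j → sym (*-assoc (c′ j) _ (κ i)))) ⟩
        0# + ∑[ j < n ] (c′ j * A (punchIn j₀ j) zero * κ i)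
          ≈⟨ trans (+-identityˡ _) (sym (*-distribʳ-sum (κ i) (λ j → c′ j * A (punchIn j₀ j) zero))) ⟩
        S₀ * κ i
          ∎
        where
        split : ∀ x a b → x * a ≈ x * (a - b) + x * b
        split x a b = trans (*-congˡ (sym (trans (+-assoc a (- b) b)
          (trans (+-congˡ (-‿inverseˡ b)) (+-identityʳ a))))) (distribˡ x (a - b) b)

      lifted-solves : Solves c′ reduced → Solves c A
      lifted-solves solves′ i = begin
        ∑[ j < suc n ] (c j * A j i)
          ≈⟨ sum-remove {i = j₀} (λ j → c j * A j i) ⟩
        c j₀ * A j₀ i + ∑[ j < n ] (c (punchIn j₀ j) * A (punchIn j₀ j) i)
          ≡⟨ ≡.cong₂ (λ γ s → γ * A j₀ i + s) (insertAt-lookup c′ j₀ _)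
                (sum-cong-≗ (λ j → ≡.cong (_* A (punchIn j₀ j) i) (insertAt-punchIn c′ j₀ _ j))) ⟩
        - (S₀ * p⁻¹) * A j₀ i + ∑[ j < n ] (c′ j * A (punchIn j₀ j) i)
          ≈⟨ +-cong (sym (-‿distribˡ-* _ (A j₀ i))) (other-rows solves′ i) ⟩
        - (S₀ * p⁻¹ * A j₀ i) + S₀ * κ i
          ≈⟨ +-congʳ (-‿cong (*-assoc S₀ p⁻¹ (A j₀ i))) ⟩
        - (S₀ * κ i) + S₀ * κ i
          ≈⟨ -‿inverseˡ (S₀ * κ i) ⟩
        0#
          ∎

      lifted-nontrivial : Nontrivial c′ → Nontrivial c
      lifted-nontrivial (j , c′j≉0) =
        punchIn j₀ j , λ cj≈0 → c′j≉0 (≡.subst (_≈ 0#) (insertAt-punchIn c′ j₀ _ j) cj≈0)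

  homogeneous-system-nontrivial-solution : ∀ {h n} → h < n → (A : Fin n → Fin h → Carrier) →
    ∃ λ c → Nontrivial c × Solves c A
  homogeneous-system-nontrivial-solution {zero} {suc n} _ A = (λ _ → 1#) , (zero , 1≉0) , λ ()
  homogeneous-system-nontrivial-solution {suc h} {suc n} (s≤s h<n) A
    with Fin.any? (λ j → ¬? (A j zero ≟ 0#))
  ... | no noPivot =
    let c , nontrivial , solves = homogeneous-system-nontrivial-solution (ℕ.m≤n⇒m≤1+n h<n) (λ j i → A j (suc i))
    in c , nontrivial , solves-zero-column {c = c} A column₀≈0 solves
    where
    column₀≈0 : ∀ j → A j zero ≈ 0#
    column₀≈0 j = decidable-stable (A j zero ≟ 0#) (λ Aj₀≉0 → noPivot (j , Aj₀≉0))
  ... | yes (j₀ , pivot≉0) =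
    let c′ , nontrivial , solves = homogeneous-system-nontrivial-solution h<n (λ j i → reduced j (suc i))
    in c c′ , lifted-nontrivial c′ nontrivial , lifted-solves c′ (solves-zero-column {c = c′} reduced reduced-column₀≈0 solves)
    where open Elimination A j₀ pivot≉0

module LinearAlgebra {q : ℕ} (F : FiniteField q) (k : ℕ) where
  open FiniteField F hiding (zero)
  open FiniteFieldProperties F
  open HomogeneousSystems F
  open PG F k
  open import Algebra.Properties.Ring ring using (-‿distribˡ-*)
  open import Algebra.Properties.Group +-group using (inverseˡ-unique)
  open import Algebra.Properties.Semiring.Sum semiring
    using (sum-syntax; sum-cong-≋; sum-replicate-zero; ∑-distrib-+; ∑-comm; *-distribˡ-sum; *-distribʳ-sum)
  open import Relation.Binary.Reasoning.Setoid setoid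

  linComb : ∀ {m} → (Fin m → Carrier) → (Fin m → Vec) → Vec
  linComb c v = sumv (λ i → c i · v i)

  _∈Span_ : ∀ {m} → Vec → (Fin m → Vec) → Set
  w ∈Span v = ∃ λ c → linComb c v ≈v w

  δ : ∀ {n} → Fin n → Fin n → Carrier
  δ zero    zero    = 1#
  δ zero    (suc _) = 0#
  δ (suc _) zero    = 0#
  δ (suc i) (suc j) = δ i j

  ∑-δ : ∀ {n} (c : Fin n → Carrier) j → ∑[ i < n ] (c i * δ i j) ≈ c j
  ∑-δ {suc n} c zero = begin
    c zero * 1# + ∑[ i < n ] (c (suc i) * 0#) ≈⟨ +-cong (*-identityʳ _) (sum-cong-≋ (λ i → zeroʳ (c (suc i)))) ⟩
    c zero + ∑[ i < n ] 0#                    ≈⟨ +-congˡ (sum-replicate-zero n) ⟩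
    c zero + 0#                               ≈⟨ +-identityʳ _ ⟩
    c zero                                    ∎
  ∑-δ {suc n} c (suc j) = trans (+-cong (zeroʳ (c zero)) (∑-δ (c ∘ suc) j)) (+-identityˡ _)

  linComb-coordinate : ∀ {m} (c : Fin m → Carrier) v l → linComb c v l ≈ ∑[ i < m ] (c i * v i l)
  linComb-coordinate {zero}  c v l = refl
  linComb-coordinate {suc m} c v l = +-congˡ (linComb-coordinate (c ∘ suc) (v ∘ suc) l)

  linComb-congˡ : ∀ {m} {c c′ : Fin m → Carrier} v → (∀ i → c i ≈ c′ i) → linComb c v ≈v linComb c′ v
  linComb-congˡ {c = c} {c′} v c≈c′ l = begin
    linComb c v l              ≈⟨ linComb-coordinate c v l ⟩
    ∑[ i < _ ] (c i * v i l)   ≈⟨ sum-cong-≋ (λ i → *-congʳ (c≈c′ i)) ⟩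
    ∑[ i < _ ] (c′ i * v i l)  ≈⟨ linComb-coordinate c′ v l ⟨
    linComb c′ v l             ∎

  linComb-congʳ : ∀ {m} (c : Fin m → Carrier) {v v′ : Fin m → Vec} → (∀ i → v i ≈v v′ i) → linComb c v ≈v linComb c v′
  linComb-congʳ c {v} {v′} v≈v′ l = begin
    linComb c v l              ≈⟨ linComb-coordinate c v l ⟩
    ∑[ i < _ ] (c i * v i l)   ≈⟨ sum-cong-≋ (λ i → *-congˡ (v≈v′ i l)) ⟩
    ∑[ i < _ ] (c i * v′ i l)  ≈⟨ linComb-coordinate c v′ l ⟨
    linComb c v′ l             ∎

  linComb-zero : ∀ {m} (v : Fin m → Vec) → linComb (λ _ → 0#) v ≈v 0v
  linComb-zero {m} v l = begin
    linComb (λ _ → 0#) v l    ≈⟨ linComb-coordinate _ v l ⟩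
    ∑[ i < m ] (0# * v i l)   ≈⟨ sum-cong-≋ (λ i → zeroˡ (v i l)) ⟩
    ∑[ i < m ] 0#             ≈⟨ sum-replicate-zero m ⟩
    0#                        ∎

  linComb-+ : ∀ {m} (c c′ : Fin m → Carrier) v → linComb (λ i → c i + c′ i) v ≈v (linComb c v +v linComb c′ v)
  linComb-+ {m} c c′ v l = begin
    linComb (λ i → c i + c′ i) v l                      ≈⟨ linComb-coordinate _ v l ⟩
    ∑[ i < m ] ((c i + c′ i) * v i l)                   ≈⟨ sum-cong-≋ (λ i → distribʳ (v i l) (c i) (c′ i)) ⟩
    ∑[ i < m ] (c i * v i l + c′ i * v i l)             ≈⟨ ∑-distrib-+ (λ i → c i * v i l) _ ⟩
    ∑[ i < m ] (c i * v i l) + ∑[ i < m ] (c′ i * v i l) ≈⟨ +-cong (linComb-coordinate c v l) (linComb-coordinate c′ v l) ⟨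
    linComb c v l + linComb c′ v l                      ∎

  linComb-· : ∀ {m} s (c : Fin m → Carrier) v → linComb (λ i → s * c i) v ≈v (s · linComb c v)
  linComb-· {m} s c v l = begin
    linComb (λ i → s * c i) v l     ≈⟨ linComb-coordinate _ v l ⟩
    ∑[ i < m ] (s * c i * v i l)    ≈⟨ sum-cong-≋ (λ i → *-assoc s (c i) (v i l)) ⟩
    ∑[ i < m ] (s * (c i * v i l))  ≈⟨ *-distribˡ-sum s (λ i → c i * v i l) ⟨
    s * ∑[ i < m ] (c i * v i l)    ≈⟨ *-congˡ (linComb-coordinate c v l) ⟨
    s * linComb c v l               ∎

  linComb-δ : ∀ {m} (v : Fin m → Vec) i → linComb (λ j → δ j i) v ≈v v i
  linComb-δ {m} v i l = begin
    linComb (λ j → δ j i) v l    ≈⟨ linComb-coordinate _ v l ⟩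
    ∑[ j < m ] (δ j i * v j l)   ≈⟨ sum-cong-≋ (λ j → *-comm (δ j i) (v j l)) ⟩
    ∑[ j < m ] (v j l * δ j i)   ≈⟨ ∑-δ (λ j → v j l) i ⟩
    v i l                        ∎

  linComb-linComb : ∀ {m n} (c : Fin n → Carrier) (A : Fin n → Fin m → Carrier) (b : Fin m → Vec) →
    linComb c (λ j → linComb (A j) b) ≈v linComb (λ i → ∑[ j < n ] (c j * A j i)) b
  linComb-linComb {m} {n} c A b l = begin
    linComb c (λ j → linComb (A j) b) l
      ≈⟨ linComb-coordinate c _ l ⟩
    ∑[ j < n ] (c j * linComb (A j) b l)
      ≈⟨ sum-cong-≋ (λ j → *-congˡ (linComb-coordinate (A j) b l)) ⟩
    ∑[ j < n ] (c j * ∑[ i < m ] (A j i * b i l))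
      ≈⟨ sum-cong-≋ (λ j → *-distribˡ-sum (c j) (λ i → A j i * b i l)) ⟩
    ∑[ j < n ] ∑[ i < m ] (c j * (A j i * b i l))
      ≈⟨ ∑-comm (λ j i → c j * (A j i * b i l)) ⟩
    ∑[ i < m ] ∑[ j < n ] (c j * (A j i * b i l))
      ≈⟨ sum-cong-≋ (λ i → sum-cong-≋ (λ j → sym (*-assoc (c j) (A j i) (b i l)))) ⟩
    ∑[ i < m ] ∑[ j < n ] (c j * A j i * b i l)
      ≈⟨ sum-cong-≋ (λ i → *-distribʳ-sum (b i l) (λ j → c j * A j i)) ⟨
    ∑[ i < m ] (∑[ j < n ] (c j * A j i) * b i l)
      ≈⟨ linComb-coordinate _ b l ⟨
    linComb (λ i → ∑[ j < n ] (c j * A j i)) b l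
      ∎

  linComb-closed : ∀ {S} → IsSubspace S → ∀ {m} (c : Fin m → Carrier) {v : Fin m → Vec} →
    (∀ i → S (v i)) → S (linComb c v)
  linComb-closed S-sub {zero}  c Sv = IsSubspace.has-0 S-sub
  linComb-closed S-sub {suc m} c Sv = IsSubspace.+-closed S-sub
    (IsSubspace.·-closed S-sub (c zero) (Sv zero)) (linComb-closed S-sub (c ∘ suc) (Sv ∘ suc))

  ∈Span-isSubspace : ∀ {m} (v : Fin m → Vec) → IsSubspace (_∈Span v)
  ∈Span-isSubspace v = record
    { respects = λ { u≈u′ (c , c↦u) → c , λ l → trans (c↦u l) (u≈u′ l) }
    ; has-0    = (λ _ → 0#) , linComb-zero v
    ; +-closed = λ { (c , c↦u) (c′ , c′↦u′) →
                   (λ i → c i + c′ i) , λ l → trans (linComb-+ c c′ v l) (+-cong (c↦u l) (c′↦u′ l)) }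
    ; ·-closed = λ { s (c , c↦u) → (λ i → s * c i) , λ l → trans (linComb-· s c v l) (*-congˡ (c↦u l)) }
    }

  ∈Span-member : ∀ {m} (v : Fin m → Vec) i → v i ∈Span v
  ∈Span-member v i = (λ j → δ j i) , linComb-δ v i

  InSpan-minimal : ∀ {S P : VSet} → IsSubspace S → (∀ {u} → P u → S u) → ∀ {w} → InSpan P w → S w
  InSpan-minimal S-sub P⊆S (_ , v , c , Pv , c↦w) =
    IsSubspace.respects S-sub c↦w (linComb-closed S-sub c (P⊆S ∘ Pv))

  ∈Span-hasDim : ∀ {m} (v : Fin m → Vec) → LinIndep v → HasDim (_∈Span v) m
  ∈Span-hasDim {m} v v-indep =
    v , ∈Span-member v , v-indep , λ { w (c , c↦w) → m , v , c , (λ i → i , ≡.refl) , c↦w }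

  basis-spans : ∀ {S d} (dim : HasDim S d) → ∀ {w} → S w → w ∈Span proj₁ dim
  basis-spans (b , _ , _ , spans) Sw =
    InSpan-minimal {P = λ u → ∃ λ i → b i ≡.≡ u} (∈Span-isSubspace b) (λ { (i , ≡.refl) → ∈Span-member b i }) (spans _ Sw)

  LinIndep-tail : ∀ {m} {v} {f : Fin m → Vec} → LinIndep (v ∷ f) → LinIndep f
  LinIndep-tail {v = v} {f} v∷f-indep c c↦0 = v∷f-indep (0# ∷ c) 0v+c↦0 ∘ suc
    where
    0v+c↦0 : linComb (0# ∷ c) (v ∷ f) ≈v 0v
    0v+c↦0 l = trans (+-congʳ (zeroˡ (v l))) (trans (+-identityˡ _) (c↦0 l))

  LinIndep-∷ : ∀ {m} {v} {f : Fin m → Vec} → LinIndep f → ¬ v ∈Span f → LinIndep (v ∷ f)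
  LinIndep-∷ {v = v} {f} f-indep v∉f c c↦0 = coefficients≈0
    where
    c₀≈0 : c zero ≈ 0#
    c₀≈0 with c zero ≟ 0#
    ... | yes c₀≈0 = c₀≈0
    ... | no c₀≉0 = ⊥-elim (v∉f ((λ i → - c₀⁻¹ * c (suc i)) , v≈))
      where
      c₀⁻¹ = proj₁ (inverse (c zero) c₀≉0)
      c₀c₀⁻¹≈1 = proj₂ (inverse (c zero) c₀≉0)
      L = linComb (c ∘ suc) f
      v+c₀⁻¹L≈0 : ∀ l → v l + c₀⁻¹ * L l ≈ 0#
      v+c₀⁻¹L≈0 l = begin
        v l + c₀⁻¹ * L l               ≈⟨ +-congʳ (*-identityˡ (v l)) ⟨
        1# * v l + c₀⁻¹ * L l          ≈⟨ +-congʳ (*-congʳ (trans (*-comm c₀⁻¹ (c zero)) c₀c₀⁻¹≈1)) ⟨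
        c₀⁻¹ * c zero * v l + c₀⁻¹ * L l ≈⟨ solve 4 (λ x y v L → x :* y :* v :+ x :* L := x :* (y :* v :+ L)) refl c₀⁻¹ (c zero) (v l) (L l) ⟩
        c₀⁻¹ * (c zero * v l + L l)    ≈⟨ *-congˡ (c↦0 l) ⟩
        c₀⁻¹ * 0#                      ≈⟨ zeroʳ c₀⁻¹ ⟩
        0#                             ∎
      v≈ : linComb (λ i → - c₀⁻¹ * c (suc i)) f ≈v v
      v≈ l = begin
        linComb (λ i → - c₀⁻¹ * c (suc i)) f l ≈⟨ linComb-· (- c₀⁻¹) (c ∘ suc) f l ⟩
        - c₀⁻¹ * L l                          ≈⟨ -‿distribˡ-* c₀⁻¹ (L l) ⟨
        - (c₀⁻¹ * L l)                        ≈⟨ inverseˡ-unique (v l) (c₀⁻¹ * L l) (v+c₀⁻¹L≈0 l) ⟨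
        v l                                   ∎
    tail↦0 : linComb (c ∘ suc) f ≈v 0v
    tail↦0 l = trans (sym (trans (+-congʳ (trans (*-congʳ c₀≈0) (zeroˡ (v l)))) (+-identityˡ _))) (c↦0 l)
    coefficients≈0 : ∀ i → c i ≈ 0#
    coefficients≈0 zero    = c₀≈0
    coefficients≈0 (suc i) = f-indep (c ∘ suc) tail↦0 i

  LinIndep⇒≤ : ∀ {m n} {b : Fin m → Vec} {w : Fin n → Vec} → LinIndep w → (∀ j → w j ∈Span b) → n ≤ m
  LinIndep⇒≤ {m} {n} {b} {w} w-indep w⊆b with n ≤? m
  ... | yes n≤m = n≤m
  ... | no  n≰m = ⊥-elim (c≉0 (w-indep c c↦0 j))
    where
    A : Fin n → Fin m → Carrier
    A j = proj₁ (w⊆b j)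
    solution = homogeneous-system-nontrivial-solution (ℕ.≰⇒> n≰m) A
    c = proj₁ solution
    j = proj₁ (proj₁ (proj₂ solution))
    c≉0 = proj₂ (proj₁ (proj₂ solution))
    c↦0 : linComb c w ≈v 0v
    c↦0 l = begin
      linComb c w l                                    ≈⟨ linComb-congʳ c (λ j → proj₂ (w⊆b j)) l ⟨
      linComb c (λ j → linComb (A j) b) l              ≈⟨ linComb-linComb c A b l ⟩
      linComb (λ i → ∑[ j < n ] (c j * A j i)) b l     ≈⟨ linComb-congˡ b (proj₂ (proj₂ solution)) l ⟩
      linComb (λ _ → 0#) b l                           ≈⟨ linComb-zero b l ⟩
      0#                                               ∎

  LinIndep⇒≤dim : ∀ {S d n} {w : Fin n → Vec} → HasDim S d → LinIndep w → (∀ j → S (w j)) → n ≤ d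
  LinIndep⇒≤dim dim w-indep Sw = LinIndep⇒≤ w-indep (λ j → basis-spans dim (Sw j))

  standardBasis : Fin k → Vec
  standardBasis = δ

  standardBasis-indep : LinIndep standardBasis
  standardBasis-indep c c↦0 j = trans (sym (∑-δ c j)) (trans (sym (linComb-coordinate c δ j)) (c↦0 j))

  ¬¬-extend-LinIndep : ∀ {m} {f : Fin m → Vec} → LinIndep f → m < k → ¬ ¬ (∃ λ v → LinIndep (v ∷ f))
  ¬¬-extend-LinIndep {f = f} f-indep m<k no-extension =
    ¬¬-∀-Fin (λ j ej∉f → no-extension (standardBasis j , LinIndep-∷ f-indep ej∉f))
             (λ basis⊆f → ℕ.<⇒≱ m<k (LinIndep⇒≤ standardBasis-indep basis⊆f))

  ¬¬-InSpan-escapes : ∀ {S P : VSet} → IsSubspace S → ∀ {w} → InSpan P w → ¬ S w →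
    ¬ ¬ (∃ λ u → P u × ¬ S u)
  ¬¬-InSpan-escapes S-sub (_ , v , c , Pv , c↦w) w∉S no-escape =
    ¬¬-∀-Fin (λ i vi∉S → no-escape (v i , Pv i , vi∉S))
             (λ Sv → w∉S (IsSubspace.respects S-sub c↦w (linComb-closed S-sub c Sv)))

-- The q + 1 hyperplanes through the span of lam, a codimension-2 subspace, are the spans of lam
-- and a point of the line ⟨a, b⟩.
module Pencil {q : ℕ} (F : FiniteField q) (k′ : ℕ) where
  open FiniteField F hiding (zero)
  open FiniteFieldProperties F
  open ProjectiveLine F
  open PG F (suc (suc k′))
  open LinearAlgebra F (suc (suc k′))
  open import Relation.Binary.Reasoning.Setoid setoid

  module _ {lam : Fin k′ → Vec} {a b : Vec} (indep : LinIndep (b ∷ a ∷ lam)) where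

    direction : Fin (suc q) → Vec
    direction τ = (pointX τ · b) +v (pointY τ · a)

    hyperplane : Fin (suc q) → VSet
    hyperplane τ = _∈Span (direction τ ∷ lam)

    axis-coefficients≈0 : ∀ X Y {w} → w ∈Span lam → ((X · b) +v ((Y · a) +v w)) ≈v 0v → X ≈ 0# × Y ≈ 0#
    axis-coefficients≈0 X Y (c , c↦w) X,Y,w↦0 = indep (X ∷ Y ∷ c) X,Y,c↦0 zero , indep (X ∷ Y ∷ c) X,Y,c↦0 (suc zero)
      where
      X,Y,c↦0 : linComb (X ∷ Y ∷ c) (b ∷ a ∷ lam) ≈v 0v
      X,Y,c↦0 l = trans (+-congˡ (+-congˡ (c↦w l))) (X,Y,w↦0 l)

    lam-indep : LinIndep lam
    lam-indep = LinIndep-tail {v = a} (LinIndep-tail {v = b} {f = a ∷ lam} indep)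

    direction∉Span : ∀ τ → ¬ direction τ ∈Span lam
    direction∉Span τ d∈lam = 1≉0 (point-nonzero τ 1#
      (trans (*-identityˡ _) (proj₁ coefficients≈0)) (trans (*-identityˡ _) (proj₂ coefficients≈0)))
      where
      d = direction τ
      -d∈lam = IsSubspace.·-closed (∈Span-isSubspace lam) (- 1#) d∈lam
      d-d↦0 : ∀ l → pointX τ * b l + (pointY τ * a l + - 1# * d l) ≈ 0#
      d-d↦0 l = begin
        pointX τ * b l + (pointY τ * a l + - 1# * d l) ≈⟨ +-assoc _ _ _ ⟨
        d l + - 1# * d l                               ≈⟨ +-congʳ (*-identityˡ (d l)) ⟨
        1# * d l + - 1# * d l                          ≈⟨ distribʳ (d l) 1# (- 1#) ⟨
        (1# - 1#) * d l                                ≈⟨ *-congʳ (-‿inverseʳ 1#) ⟩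
        0# * d l                                       ≈⟨ zeroˡ (d l) ⟩
        0#                                             ∎
      coefficients≈0 = axis-coefficients≈0 (pointX τ) (pointY τ) -d∈lam d-d↦0

    hyperplane-isHyperplane : ∀ τ → IsHyperplane (hyperplane τ)
    hyperplane-isHyperplane τ =
      ∈Span-isSubspace (direction τ ∷ lam) ,
      ∈Span-hasDim (direction τ ∷ lam) (LinIndep-∷ lam-indep (direction∉Span τ))

    direction∈hyperplane : ∀ τ → hyperplane τ (direction τ)
    direction∈hyperplane τ = ∈Span-member (direction τ ∷ lam) zero

    off-axis-decomposition : ∀ τ {u} → hyperplane τ u → ¬ u ∈Span lam →
      ∃ λ x → ¬ x ≈ 0# × ∃ λ r → r ∈Span lam × (u ≈v ((x · direction τ) +v r))
    off-axis-decomposition τ {u} (c , c↦u) u∉lam =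
      c zero , c₀≉0 , linComb (c ∘ suc) lam , (c ∘ suc , λ _ → refl) , λ l → sym (c↦u l)
      where
      c₀≉0 : ¬ c zero ≈ 0#
      c₀≉0 c₀≈0 = u∉lam (c ∘ suc , λ l →
        trans (sym (trans (+-congʳ (trans (*-congʳ c₀≈0) (zeroˡ _))) (+-identityˡ _))) (c↦u l))

    off-axis-points-independent : ∀ {τ σ} → τ ≡.≢ σ → ∀ {u u′ m} {β : Fin m → Vec} →
      hyperplane τ u → ¬ u ∈Span lam → hyperplane σ u′ → ¬ u′ ∈Span lam →
      LinIndep β → (∀ j → β j ∈Span lam) → LinIndep (u ∷ u′ ∷ β)
    off-axis-points-independent {τ} {σ} τ≢σ {u} {u′} {β = β} u∈H u∉lam u′∈H u′∉lam β-indep β⊆lam c c↦0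
      with off-axis-decomposition τ u∈H u∉lam | off-axis-decomposition σ u′∈H u′∉lam
    ... | x , x≉0 , r , r∈lam , u≈ | x′ , x′≉0 , r′ , r′∈lam , u′≈ = coefficients≈0
      where
      open IsSubspace (∈Span-isSubspace lam)
      c₀ = c zero
      c₁ = c (suc zero)
      c₊ : Fin _ → Carrier
      c₊ j = c (suc (suc j))
      Z = linComb c₊ β
      R = (c₀ · r) +v ((c₁ · r′) +v Z)
      R∈lam : R ∈Span lam
      R∈lam = +-closed (·-closed c₀ r∈lam)
                (+-closed (·-closed c₁ r′∈lam) (linComb-closed (∈Span-isSubspace lam) c₊ β⊆lam))
      X = c₀ * x * pointX τ + c₁ * x′ * pointX σ
      Y = c₀ * x * pointY τ + c₁ * x′ * pointY σ
      regrouped : ((X · b) +v ((Y · a) +v R)) ≈v 0v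
      regrouped l = begin
        X * b l + (Y * a l + R l)
          ≈⟨ solve 13 (λ c₀ c₁ x x′ Xτ Yτ Xσ Yσ bl al rl r′l Zl →
               (c₀ :* x :* Xτ :+ c₁ :* x′ :* Xσ) :* bl :+ ((c₀ :* x :* Yτ :+ c₁ :* x′ :* Yσ) :* al :+ (c₀ :* rl :+ (c₁ :* r′l :+ Zl)))
               := c₀ :* (x :* (Xτ :* bl :+ Yτ :* al) :+ rl) :+ (c₁ :* (x′ :* (Xσ :* bl :+ Yσ :* al) :+ r′l) :+ Zl))
               refl c₀ c₁ x x′ (pointX τ) (pointY τ) (pointX σ) (pointY σ) (b l) (a l) (r l) (r′ l) (Z l) ⟩
        c₀ * (x * direction τ l + r l) + (c₁ * (x′ * direction σ l + r′ l) + Z l)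
          ≈⟨ +-cong (*-congˡ (u≈ l)) (+-congʳ (*-congˡ (u′≈ l))) ⟨
        c₀ * u l + (c₁ * u′ l + Z l)
          ≈⟨ c↦0 l ⟩
        0#
          ∎
      X≈0,Y≈0 = axis-coefficients≈0 X Y R∈lam regrouped
      c₀≈0 : c₀ ≈ 0#
      c₀≈0 = *-cancelʳ-≉0 c₀ x≉0
        (distinct-points-independent τ≢σ (c₀ * x) (c₁ * x′) (proj₁ X≈0,Y≈0) (proj₂ X≈0,Y≈0))
      c₁≈0 : c₁ ≈ 0#
      c₁≈0 = *-cancelʳ-≉0 c₁ x′≉0 (distinct-points-independent (τ≢σ ∘ ≡.sym) (c₁ * x′) (c₀ * x)
        (trans (+-comm _ _) (proj₁ X≈0,Y≈0)) (trans (+-comm _ _) (proj₂ X≈0,Y≈0)))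
      Z↦0 : Z ≈v 0v
      Z↦0 l = begin
        Z l                          ≈⟨ +-identityˡ _ ⟨
        0# + Z l                     ≈⟨ +-identityˡ _ ⟨
        0# + (0# + Z l)              ≈⟨ +-cong (trans (*-congʳ c₀≈0) (zeroˡ _)) (+-congʳ (trans (*-congʳ c₁≈0) (zeroˡ _))) ⟨
        c₀ * u l + (c₁ * u′ l + Z l) ≈⟨ c↦0 l ⟩
        0#                           ∎
      coefficients≈0 : ∀ i → c i ≈ 0#
      coefficients≈0 zero          = c₀≈0
      coefficients≈0 (suc zero)    = c₁≈0
      coefficients≈0 (suc (suc j)) = β-indep c₊ Z↦0 j

module FewBlockingSubspaces {q : ℕ} (F : FiniteField q) (k′ : ℕ) where
  open PG F (suc (suc k′))
  open LinearAlgebra F (suc (suc k′))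
  open Pencil F k′

  module _ {h N} {U : Fin N → VSet} (U-dim : ∀ i → ProjSubspaceVecDim (U i) h)
           (blocking : StrongBlocking (PointUnion U))
           {Λ : VSet} (Λ-dim : HasDim Λ k′) (meets : ∀ i → Σ ℕ λ m → (h ∸ 1 ≤ m) × HasDim (Λ ∩ U i) m)
           {a b : Vec} (indep : LinIndep (b ∷ a ∷ proj₁ Λ-dim)) where

    lam : Fin k′ → Vec
    lam = proj₁ Λ-dim

    OffAxisPoint : Fin N → Fin (suc q) → Set
    OffAxisPoint i τ = ∃ λ u → U i u × hyperplane indep τ u × ¬ u ∈Span lam

    ¬¬-off-axis-point : ∀ τ → ¬ ¬ (∃ λ i → OffAxisPoint i τ)
    ¬¬-off-axis-point τ none =
      ¬¬-InSpan-escapes {P = PointUnion U ∩ hyperplane indep τ} (∈Span-isSubspace lam) direction∈⟨U∩H⟩ (direction∉Span indep τ)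
        λ { (u , ((_ , i , u∈U) , u∈H) , u∉lam) → none (i , u , u∈U , u∈H , u∉lam) }
      where
      direction∈⟨U∩H⟩ = proj₂ (blocking (hyperplane indep τ) (hyperplane-isHyperplane indep τ))
                               (direction indep τ) (direction∈hyperplane indep τ)

    off-axis-points-in-one-hyperplane : ∀ i {τ σ} → OffAxisPoint i τ → OffAxisPoint i σ → ¬ τ ≡.≢ σ
    off-axis-points-in-one-hyperplane i (u , u∈U , u∈H , u∉lam) (u′ , u′∈U , u′∈H , u′∉lam) τ≢σ
      with meets i
    ... | m , h∸1≤m , β , β∈Λ∩U , β-indep , _ = ℕ.<⇒≱ (ℕ.∸-monoˡ-≤ 1 m+2≤h) h∸1≤m
      where
      w∈U : ∀ j → U i ((u ∷ u′ ∷ β) j)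
      w∈U zero          = u∈U
      w∈U (suc zero)    = u′∈U
      w∈U (suc (suc j)) = proj₂ (β∈Λ∩U j)
      m+2≤h : suc (suc m) ≤ h
      m+2≤h = LinIndep⇒≤dim (proj₂ (U-dim i))
        (off-axis-points-independent indep τ≢σ u∈H u∉lam u′∈H u′∉lam β-indep
          (λ j → basis-spans Λ-dim (proj₁ (β∈Λ∩U j))))
        w∈U

    pencil-needs-q+1-subspaces : N < suc q → ⊥
    pencil-needs-q+1-subspaces N<q+1 = ¬¬-∀-Fin ¬¬-off-axis-point λ point →
      let τ , σ , τ<σ , same = Fin.pigeonhole N<q+1 (proj₁ ∘ point)
      in off-axis-points-in-one-hyperplane (proj₁ (point τ)) (proj₂ (point τ))
           (≡.subst (λ i → OffAxisPoint i σ) (≡.sym same) (proj₂ (point σ))) (Fin.<⇒≢ τ<σ)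

  few-blocking-subspaces-avoid : ∀ {h N} {U : Fin N → VSet} → (∀ i → ProjSubspaceVecDim (U i) h) →
    StrongBlocking (PointUnion U) → N < suc q → AvoidanceProperty h U
  few-blocking-subspaces-avoid U-dim blocking N<q+1 (Λ , (_ , Λ-dim) , meets) =
    ¬¬-extend-LinIndep (proj₁ (proj₂ (proj₂ Λ-dim))) (ℕ.n≤1+n (suc k′)) λ (a , a∷lam-indep) →
    ¬¬-extend-LinIndep {f = a ∷ proj₁ Λ-dim} a∷lam-indep ℕ.≤-refl λ (b , indep) →
    pencil-needs-q+1-subspaces U-dim blocking Λ-dim meets indep N<q+1

mainTheorem11 : ∀ {q : ℕ} (F : FiniteField q) (k h N : ℕ) (U : Fin N → PG.VSet F k) →
    2 ≤ k →
    (∀ i → PG.ProjSubspaceVecDim F k (U i) h) →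
    ¬ PG.AvoidanceProperty F k h U →
    PG.StrongBlocking F k (PG.PointUnion F k U) →
    suc q ≤ N
mainTheorem11 {q} F (suc (suc k′)) h N U (s≤s (s≤s z≤n)) U-dim not-avoiding blocking with suc q ≤? N
... | yes q+1≤N = q+1≤N
... | no  q+1≰N = ⊥-elim (not-avoiding (few-blocking-subspaces-avoid U-dim blocking (ℕ.≰⇒> q+1≰N)))
  where open FewBlockingSubspaces F k′
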